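{- Let $k,N$ be positive integers and let $\mathbf a=(a_1,\dots,a_k,0,\dots,0)\in\mathbb Z^N$, $\mathbf b=(k,\dots,k,1,\dots,1,0,\dots,0)\in\mathbb Z^N$ with $\sum_{i=1}^k a_i=\sum_{i=1}^N b_i=:S$. Let $q$ be the number of entries of $\mathbf b$ equal to $k$ and $p=\min\{a_1,\dots,a_k\}$. If $p<q$, no graph realizes $(\mathbf a,\mathbf b)$. If $p\ge q$, the number of graphs realizing $(\mathbf a,\mathbf b)$ is $$\frac{(S-qk)!}{\prod_{i=1}^k (a_i-q)!}.$$ Similarly, if $\mathbf a=(k,\dots,k,1,\dots,1,0,\dots,0)$ and $\mathbf b=(b_1,\dots,b_k,0,\dots,0)$ with equal sums $S$, $q$ the number of entries of $\mathbf a$ equal to $k$ and $p=\min\{b_1,\dots,b_k\}$, then no graph realizes it if $p<q$, and otherwise there are $\frac{(S-qk)!}{\prod_{i=1}^k(b_i-q)!}$ such graphs.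
   Context: A graph realizing $(\mathbf a,\mathbf b)$ is a directed graph on $\{1,\dots,N\}$ in which each ordered pair $(u,v)$, including loops $u=v$, carries at most one edge, and node $n$ has in-degree $a_n$ and out-degree $b_n$; equivalently an $N\times N$ $0$-$1$ matrix with row sums $\mathbf a$ and column sums $\mathbf b$. -}

module Defs where

open import Data.Nat using (ℕ; zero; suc; _+_; _*_; _∸_; _≤_; _<_; _<?_; _⊓_)
open import Data.Nat.Properties using (_≟_)
open import Data.Bool using (Bool; true; false)
open import Data.Fin using (Fin; toℕ; fromℕ<) renaming (zero to fzero; suc to fsuc)
open import Data.Fin.Properties using (all?)
open import Data.Vec using (Vec; []; _∷_; lookup)
open import Data.List using (List; []; _∷_; length; filter; concatMap; map; tabulate)
open import Data.Nat.ListAction using (sum; product)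
open import Data.Product using (_×_; _,_)
open import Relation.Nullary using (Dec; yes; no)
open import Relation.Nullary.Decidable using (_×-dec_)
open import Relation.Binary.PropositionalEquality using (_≡_)

bit : Bool → ℕ
bit true  = 1
bit false = 0

sumF : {n : ℕ} → (Fin n → ℕ) → ℕ
sumF {n} f = sum (tabulate {n = n} f)

prodF : {n : ℕ} → (Fin n → ℕ) → ℕ
prodF {n} f = product (tabulate {n = n} f)

-- minimum over Fin k (value 0 for k = 0, only used for k ≥ 1)
minF : (k : ℕ) → (Fin k → ℕ) → ℕ
minF zero f = 0
minF (suc zero) f = f fzero
minF (suc (suc k)) f = f fzero ⊓ minF (suc k) (λ i → f (fsuc i))

countEq : {n : ℕ} → ℕ → (Fin n → ℕ) → ℕ
countEq {n} v f = length (filter (λ i → f i ≟ v) (tabulate {n = n} (λ i → i)))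

pad : (k N : ℕ) → (Fin k → ℕ) → Fin N → ℕ
pad k N x i with toℕ i <? k
... | yes lt = x (fromℕ< lt)
... | no _   = 0

shape : (N k q' r : ℕ) → Fin N → ℕ
shape N k q' r i with toℕ i <? q'
... | yes _ = k
... | no _ with toℕ i <? q' + r
...   | yes _ = 1
...   | no _  = 0

Matrix : ℕ → Set
Matrix N = Vec (Vec Bool N) N

rowSum : {N : ℕ} → Matrix N → Fin N → ℕ
rowSum M i = sumF (λ j → bit (lookup (lookup M i) j))

colSum : {N : ℕ} → Matrix N → Fin N → ℕ
colSum M j = sumF (λ i → bit (lookup (lookup M i) j))

Realizes : {N : ℕ} → (Fin N → ℕ) → (Fin N → ℕ) → Matrix N → Set
Realizes a b M = (∀ i → rowSum M i ≡ a i) × (∀ j → colSum M j ≡ b j)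

realizes? : {N : ℕ} → (a b : Fin N → ℕ) → (M : Matrix N) → Dec (Realizes a b M)
realizes? a b M = all? (λ i → rowSum M i ≟ a i) ×-dec all? (λ j → colSum M j ≟ b j)

allVecs : {A : Set} → (n : ℕ) → List A → List (Vec A n)
allVecs zero xs = [] ∷ []
allVecs (suc n) xs = concatMap (λ x → map (x ∷_) (allVecs n xs)) xs

allMatrices : (N : ℕ) → List (Matrix N)
allMatrices N = allVecs N (allVecs N (true ∷ false ∷ []))

-- number of graphs (0-1 matrices) realizing (a, b)
numRealizations : {N : ℕ} → (Fin N → ℕ) → (Fin N → ℕ) → ℕ
numRealizations {N} a b = length (filter (realizes? a b) (allMatrices N))

-- Realizations are 0-1 matrices with row sums (k,…,k,1,…,1,0,…,0) and column sums (x₁,…,x_k,0,…,0);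
-- count them one row at a time. As the column sums vanish beyond the first k columns, each of the q
-- rows of sum k is forced to be (1,…,1,0,…,0), and removing it lowers each x_i by one. So there is no
-- realization if some x_i < q; otherwise there remain ρ = S − qk rows with a single 1 each, to be
-- placed so that column i receives x_i − q of them, which is the multinomial count
-- (S − qk)! / ∏ (x_i − q)!. The other orientation is the transpose.

module Submission where

open import Defs
open import Data.Bool using (Bool; true; false)
open import Data.Empty using (⊥-elim)
open import Data.Fin using (Fin; toℕ; fromℕ<; inject≤) renaming (zero to fzero; suc to fsuc)
open import Data.Fin.Properties using (all?; toℕ<n; toℕ-inject≤; fromℕ<-cong; fromℕ<-toℕ)
open import Data.List using (List; []; _∷_; _++_; length; filter; map; concatMap; tabulate)
open import Data.List.Properties using (tabulate-cong)
open import Data.Nat using (ℕ; zero; suc; _+_; _*_; _∸_; _≤_; _<_; _!; z≤n; s≤s; _≤?_; _<?_)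
open import Data.Nat.ListAction using (sum; product)
open import Data.Nat.Properties
open import Algebra.Properties.CommutativeSemigroup +-commutativeSemigroup
  using () renaming (interchange to +-interchange)
open import Algebra.Properties.CommutativeSemigroup *-commutativeSemigroup
  using () renaming (x∙yz≈y∙xz to *-left-comm)
open import Data.Product using (Σ-syntax; _×_; _,_; proj₁)
open import Data.Sum using (_⊎_; inj₁; inj₂; [_,_]′; map₂)
open import Data.Vec using (Vec; []; _∷_; lookup; replicate; transpose; _⊛_)
open import Data.Vec.Properties using (lookup-replicate; ∷-injectiveˡ; ∷-injectiveʳ)
open import Function using (id)
open import Relation.Binary.PropositionalEquality
  using (_≡_; _≢_; _≗_; refl; sym; trans; cong; cong₂; subst; subst₂; module ≡-Reasoning)
open import Relation.Nullary using (Dec; yes; no; ¬_)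
open import Relation.Nullary.Decidable using (_×-dec_)
open import Relation.Unary using (Pred; Decidable)

open ≡-Reasoning

private
  variable
    A B : Set
    k m n : ℕ

∑ : List A → (A → ℕ) → ℕ
∑ []       g = 0
∑ (x ∷ xs) g = g x + ∑ xs g

syntax ∑ xs (λ x → e) = ∑[ x ∈ xs ] e

∑-cong : (xs : List A) {g h : A → ℕ} → g ≗ h → ∑ xs g ≡ ∑ xs h
∑-cong []       g≗h = refl
∑-cong (x ∷ xs) g≗h = cong₂ _+_ (g≗h x) (∑-cong xs g≗h)

∑-zero : (xs : List A) {g : A → ℕ} → (∀ x → g x ≡ 0) → ∑ xs g ≡ 0
∑-zero []       g≡0 = refl
∑-zero (x ∷ xs) g≡0 = cong₂ _+_ (g≡0 x) (∑-zero xs g≡0)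

∑-++ : (xs ys : List A) (g : A → ℕ) → ∑ (xs ++ ys) g ≡ ∑ xs g + ∑ ys g
∑-++ []       ys g = refl
∑-++ (x ∷ xs) ys g = trans (cong (g x +_) (∑-++ xs ys g)) (sym (+-assoc (g x) _ _))

∑-+ : (xs : List A) (g h : A → ℕ) → ∑[ x ∈ xs ] (g x + h x) ≡ ∑ xs g + ∑ xs h
∑-+ []       g h = refl
∑-+ (x ∷ xs) g h = trans (cong (g x + h x +_) (∑-+ xs g h)) (+-interchange (g x) (h x) _ _)

∑-map : (f : A → B) (xs : List A) (g : B → ℕ) → ∑ (map f xs) g ≡ ∑[ x ∈ xs ] g (f x)
∑-map f []       g = refl
∑-map f (x ∷ xs) g = cong (g (f x) +_) (∑-map f xs g)

∑-concatMap : (f : A → List B) (xs : List A) (g : B → ℕ) →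
  ∑ (concatMap f xs) g ≡ ∑[ x ∈ xs ] ∑ (f x) g
∑-concatMap f []       g = refl
∑-concatMap f (x ∷ xs) g =
  trans (∑-++ (f x) (concatMap f xs) g) (cong (∑ (f x) g +_) (∑-concatMap f xs g))

∑-comm : (xs : List A) (ys : List B) (f : A → B → ℕ) →
  ∑[ x ∈ xs ] ∑[ y ∈ ys ] f x y ≡ ∑[ y ∈ ys ] ∑[ x ∈ xs ] f x y
∑-comm []       ys f = sym (∑-zero ys (λ _ → refl))
∑-comm (x ∷ xs) ys f = trans (cong (∑ ys (f x) +_) (∑-comm xs ys f))
                             (sym (∑-+ ys (f x) (λ y → ∑[ x ∈ xs ] f x y)))

∑-allVecs-suc : (n : ℕ) (xs : List A) (g : Vec A (suc n) → ℕ) →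
  ∑ (allVecs (suc n) xs) g ≡ ∑[ x ∈ xs ] ∑[ v ∈ allVecs n xs ] g (x ∷ v)
∑-allVecs-suc n xs g = trans (∑-concatMap (λ x → map (x ∷_) (allVecs n xs)) xs g)
                             (∑-cong xs (λ x → ∑-map (x ∷_) (allVecs n xs) g))

∑-tabulate : (h : Fin n → A) (g : A → ℕ) → ∑ (tabulate h) g ≡ sumF (λ i → g (h i))
∑-tabulate {n = zero}  h g = refl
∑-tabulate {n = suc n} h g = cong (g (h fzero) +_) (∑-tabulate (λ i → h (fsuc i)) g)

indicator : {P : Set} → Dec P → ℕ
indicator (yes _) = 1
indicator (no _)  = 0

indicator-⇔ : {P Q : Set} → (P → Q) → (Q → P) → (p : Dec P) (q : Dec Q) → indicator p ≡ indicator q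
indicator-⇔ P→Q Q→P (yes p) (yes q) = refl
indicator-⇔ P→Q Q→P (yes p) (no ¬q) = ⊥-elim (¬q (P→Q p))
indicator-⇔ P→Q Q→P (no ¬p) (yes q) = ⊥-elim (¬p (Q→P q))
indicator-⇔ P→Q Q→P (no ¬p) (no ¬q) = refl

indicator-yes : {P : Set} → P → (p : Dec P) → indicator p ≡ 1
indicator-yes p (yes _) = refl
indicator-yes p (no ¬p) = ⊥-elim (¬p p)

indicator-no : {P : Set} → ¬ P → (p : Dec P) → indicator p ≡ 0
indicator-no ¬p (yes p) = ⊥-elim (¬p p)
indicator-no ¬p (no _)  = refl

length-filter≡∑ : {P : Pred A _} (P? : Decidable P) (xs : List A) →
  length (filter P? xs) ≡ ∑[ x ∈ xs ] indicator (P? x)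
length-filter≡∑ P? [] = refl
length-filter≡∑ P? (x ∷ xs) with P? x
... | yes _ = cong suc (length-filter≡∑ P? xs)
... | no _  = length-filter≡∑ P? xs

sumF-cong : {f g : Fin n → ℕ} → f ≗ g → sumF f ≡ sumF g
sumF-cong f≗g = cong sum (tabulate-cong f≗g)

prodF-cong : {f g : Fin n → ℕ} → f ≗ g → prodF f ≡ prodF g
prodF-cong f≗g = cong product (tabulate-cong f≗g)

sumF-zero : {f : Fin n → ℕ} → (∀ i → f i ≡ 0) → sumF f ≡ 0
sumF-zero {zero}  f≡0 = refl
sumF-zero {suc n} f≡0 = cong₂ _+_ (f≡0 fzero) (sumF-zero (λ i → f≡0 (fsuc i)))

prodF-one : {f : Fin n → ℕ} → (∀ i → f i ≡ 1) → prodF f ≡ 1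
prodF-one {zero}  f≡1 = refl
prodF-one {suc n} f≡1 = cong₂ _*_ (f≡1 fzero) (prodF-one (λ i → f≡1 (fsuc i)))

≤-sumF : (f : Fin n → ℕ) (i : Fin n) → f i ≤ sumF f
≤-sumF f fzero    = m≤m+n (f fzero) _
≤-sumF f (fsuc i) = ≤-trans (≤-sumF (λ i → f (fsuc i)) i) (m≤n+m _ (f fzero))

sumF≡0⇒ : (f : Fin n → ℕ) → sumF f ≡ 0 → ∀ i → f i ≡ 0
sumF≡0⇒ f Σf≡0 i = n≤0⇒n≡0 (subst (f i ≤_) Σf≡0 (≤-sumF f i))

sumF-*ʳ : (f : Fin n → ℕ) (c : ℕ) → sumF f * c ≡ sumF (λ i → f i * c)
sumF-*ʳ {zero}  f c = refl
sumF-*ʳ {suc n} f c =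
  trans (*-distribʳ-+ c (f fzero) _) (cong (f fzero * c +_) (sumF-*ʳ (λ i → f (fsuc i)) c))

sumF-+ : (f g : Fin n → ℕ) → sumF (λ i → f i + g i) ≡ sumF f + sumF g
sumF-+ {zero}  f g = refl
sumF-+ {suc n} f g = trans (cong (f fzero + g fzero +_) (sumF-+ (λ i → f (fsuc i)) (λ i → g (fsuc i))))
                           (+-interchange (f fzero) (g fzero) _ _)

sumF-∸ : (f g : Fin n → ℕ) → (∀ i → g i ≤ f i) → sumF (λ i → f i ∸ g i) + sumF g ≡ sumF f
sumF-∸ f g g≤f = trans (sym (sumF-+ (λ i → f i ∸ g i) g)) (sumF-cong (λ i → m∸n+n≡m (g≤f i)))

Row : ℕ → Set
Row n = Vec Bool n

Rows : (n : ℕ) → List (Row n)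
Rows n = allVecs n (true ∷ false ∷ [])

weight : Row n → ℕ
weight v = sumF (λ j → bit (lookup v j))

∑-Rows-suc : (g : Row (suc n) → ℕ) →
  ∑ (Rows (suc n)) g ≡ ∑[ v ∈ Rows n ] g (true ∷ v) + ∑[ v ∈ Rows n ] g (false ∷ v)
∑-Rows-suc {n} g = trans (∑-allVecs-suc n _ g) (cong (∑[ v ∈ Rows n ] g (true ∷ v) +_) (+-identityʳ _))

weight-replicate : weight (replicate n false) ≡ 0
weight-replicate {zero}  = refl
weight-replicate {suc n} = weight-replicate {n}

weight≡0⇒replicate : (v : Row n) → weight v ≡ 0 → v ≡ replicate n false
weight≡0⇒replicate []          _ = refl
weight≡0⇒replicate (true ∷ v)  ()
weight≡0⇒replicate (false ∷ v) e = cong (false ∷_) (weight≡0⇒replicate v e)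

_⊆_ : Row n → Row n → Set
u ⊆ v = ∀ j → lookup u j ≡ true → lookup v j ≡ true

⊆⇒weight≤ : (u v : Row n) → u ⊆ v → weight u ≤ weight v
⊆⇒weight≤ []          []          _   = z≤n
⊆⇒weight≤ (true ∷ u)  (true ∷ v)  u⊆v = s≤s (⊆⇒weight≤ u v (λ j → u⊆v (fsuc j)))
⊆⇒weight≤ (true ∷ u)  (false ∷ v) u⊆v with () ← u⊆v fzero refl
⊆⇒weight≤ (false ∷ u) (y ∷ v)     u⊆v = ≤-trans (⊆⇒weight≤ u v (λ j → u⊆v (fsuc j))) (m≤n+m _ (bit y))

⊆∧weight≡⇒≡ : (u v : Row n) → u ⊆ v → weight u ≡ weight v → u ≡ v
⊆∧weight≡⇒≡ []          []          _   _ = refl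
⊆∧weight≡⇒≡ (true ∷ u)  (true ∷ v)  u⊆v e =
  cong (true ∷_) (⊆∧weight≡⇒≡ u v (λ j → u⊆v (fsuc j)) (suc-injective e))
⊆∧weight≡⇒≡ (true ∷ u)  (false ∷ v) u⊆v e with () ← u⊆v fzero refl
⊆∧weight≡⇒≡ (false ∷ u) (false ∷ v) u⊆v e = cong (false ∷_) (⊆∧weight≡⇒≡ u v (λ j → u⊆v (fsuc j)) e)
⊆∧weight≡⇒≡ (false ∷ u) (true ∷ v)  u⊆v e =
  ⊥-elim (1+n≰n (subst (_≤ weight v) e (⊆⇒weight≤ u v (λ j → u⊆v (fsuc j)))))

ConcentratedOn : Vec A n → (Vec A n → ℕ) → Set
ConcentratedOn s g = ∀ v → g v ≡ 0 ⊎ v ≡ s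

concentratedOn-∷ : {b : A} {s : Vec A n} {g : Vec A (suc n) → ℕ} →
  ConcentratedOn (b ∷ s) g → ConcentratedOn s (λ v → g (b ∷ v))
concentratedOn-∷ g≡0∨≡s v = map₂ ∷-injectiveʳ (g≡0∨≡s (_ ∷ v))

concentratedOn-≢ : {b c : A} {s : Vec A n} {g : Vec A (suc n) → ℕ} →
  ConcentratedOn (b ∷ s) g → c ≢ b → ∀ v → g (c ∷ v) ≡ 0
concentratedOn-≢ g≡0∨≡s c≢b v = [ id , (λ e → ⊥-elim (c≢b (∷-injectiveˡ e))) ]′ (g≡0∨≡s (_ ∷ v))

∑-Rows-single : (s : Row n) (g : Row n → ℕ) → ConcentratedOn s g → ∑ (Rows n) g ≡ g s
∑-Rows-single []          g g≡0∨≡s = +-identityʳ (g [])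
∑-Rows-single (true ∷ s)  g g≡0∨≡s = begin
  ∑ (Rows _) g
    ≡⟨ ∑-Rows-suc g ⟩
  ∑[ v ∈ Rows _ ] g (true ∷ v) + ∑[ v ∈ Rows _ ] g (false ∷ v)
    ≡⟨ cong₂ _+_ (∑-Rows-single s _ (concentratedOn-∷ g≡0∨≡s))
                 (∑-zero (Rows _) (concentratedOn-≢ g≡0∨≡s λ ())) ⟩
  g (true ∷ s) + 0
    ≡⟨ +-identityʳ _ ⟩
  g (true ∷ s) ∎
∑-Rows-single (false ∷ s) g g≡0∨≡s = trans (∑-Rows-suc g)
  (cong₂ _+_ (∑-zero (Rows _) (concentratedOn-≢ g≡0∨≡s λ ())) (∑-Rows-single s _ (concentratedOn-∷ g≡0∨≡s)))

unit : Fin n → Row n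
unit {suc n} fzero = true ∷ replicate n false
unit (fsuc j)      = false ∷ unit j

weight-unit : (j : Fin n) → weight (unit j) ≡ 1
weight-unit {suc n} fzero = cong suc (weight-replicate {n})
weight-unit (fsuc j)      = weight-unit j

lookup-unit-self : (j : Fin n) → lookup (unit j) j ≡ true
lookup-unit-self fzero    = refl
lookup-unit-self (fsuc j) = lookup-unit-self j

lookup-unit-true⇒≡ : (j i : Fin n) → lookup (unit j) i ≡ true → i ≡ j
lookup-unit-true⇒≡ fzero    fzero    _ = refl
lookup-unit-true⇒≡ fzero    (fsuc i) e with () ← trans (sym e) (lookup-replicate i false)
lookup-unit-true⇒≡ (fsuc j) (fsuc i) e = cong fsuc (lookup-unit-true⇒≡ j i e)

∑-Rows-units : (g : Row n → ℕ) → (∀ v → g v ≡ 0 ⊎ weight v ≡ 1) → ∑ (Rows n) g ≡ sumF (λ j → g (unit j))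
∑-Rows-units {zero} g g≡0∨weight1 with g≡0∨weight1 []
... | inj₁ g[]≡0 = trans (+-identityʳ _) g[]≡0
... | inj₂ ()
∑-Rows-units {suc n} g g≡0∨weight1 = trans (∑-Rows-suc g) (cong₂ _+_ head-true head-false)
  where
  head-true : ∑[ v ∈ Rows n ] g (true ∷ v) ≡ g (unit fzero)
  head-true = ∑-Rows-single (replicate n false) _
    (λ v → map₂ (λ e → weight≡0⇒replicate v (suc-injective e)) (g≡0∨weight1 (true ∷ v)))
  head-false : ∑[ v ∈ Rows n ] g (false ∷ v) ≡ sumF (λ j → g (unit (fsuc j)))
  head-false = ∑-Rows-units _ (λ v → g≡0∨weight1 (false ∷ v))

-- Counting 0-1 matrices row by row

Mat : ℕ → ℕ → Set
Mat m n = Vec (Row n) m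

Mats : (m n : ℕ) → List (Mat m n)
Mats m n = allVecs m (Rows n)

colWeight : Mat m n → Fin n → ℕ
colWeight M j = sumF (λ i → bit (lookup (lookup M i) j))

RealizesR : (Fin m → ℕ) → (Fin n → ℕ) → Mat m n → Set
RealizesR a b M = (∀ i → weight (lookup M i) ≡ a i) × (∀ j → colWeight M j ≡ b j)

realizesR? : (a : Fin m → ℕ) (b : Fin n → ℕ) (M : Mat m n) → Dec (RealizesR a b M)
realizesR? a b M = all? (λ i → weight (lookup M i) ≟ a i) ×-dec all? (λ j → colWeight M j ≟ b j)

countR : (Fin m → ℕ) → (Fin n → ℕ) → ℕ
countR {m} {n} a b = ∑[ M ∈ Mats m n ] indicator (realizesR? a b M)

-- realizes? is realizesR? on square matrices, definitionally.
numRealizations≡countR : (a b : Fin n → ℕ) → numRealizations a b ≡ countR a b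
numRealizations≡countR {n} a b = length-filter≡∑ (realizes? a b) (allMatrices n)

countR-cong : {a a′ : Fin m → ℕ} {b b′ : Fin n → ℕ} → a ≗ a′ → b ≗ b′ → countR a b ≡ countR a′ b′
countR-cong {m} {n} a≗a′ b≗b′ = ∑-cong (Mats m n) (λ M → indicator-⇔
  (λ (rows , cols) → (λ i → trans (rows i) (a≗a′ i)) , (λ j → trans (cols j) (b≗b′ j)))
  (λ (rows , cols) → (λ i → trans (rows i) (sym (a≗a′ i))) , (λ j → trans (cols j) (sym (b≗b′ j))))
  (realizesR? _ _ M) (realizesR? _ _ M))

_∸ʳ_ : (Fin n → ℕ) → Row n → Fin n → ℕ
(b ∸ʳ v) j = b j ∸ bit (lookup v j)

_≤ʳ_ : Row n → (Fin n → ℕ) → Set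
v ≤ʳ b = ∀ j → bit (lookup v j) ≤ b j

≤ʳ⇒1≤ : (v : Row n) {b : Fin n → ℕ} {j : Fin n} → v ≤ʳ b → lookup v j ≡ true → 1 ≤ b j
≤ʳ⇒1≤ v {b} {j} v≤b vⱼ≡true = subst (λ x → bit x ≤ b j) vⱼ≡true (v≤b j)

sumF-∸ʳ : {v : Row n} {b : Fin n → ℕ} {s : ℕ} → v ≤ʳ b → sumF b ≡ weight v + s → sumF (b ∸ʳ v) ≡ s
sumF-∸ʳ {v = v} {b} {s} v≤b Σb = +-cancelˡ-≡ (weight v) _ _ (begin
  weight v + sumF (b ∸ʳ v) ≡⟨ +-comm (weight v) _ ⟩
  sumF (b ∸ʳ v) + weight v ≡⟨ sumF-∸ b (λ j → bit (lookup v j)) v≤b ⟩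
  sumF b                   ≡⟨ Σb ⟩
  weight v + s             ∎)

completions : (a : Fin (suc m) → ℕ) (b : Fin n → ℕ) → Row n → ℕ
completions {m} {n} a b v = ∑[ M ∈ Mats m n ] indicator (realizesR? a b (v ∷ M))

countR-suc : (a : Fin (suc m) → ℕ) (b : Fin n → ℕ) → countR a b ≡ ∑[ v ∈ Rows n ] completions a b v
countR-suc {m} {n} a b = ∑-allVecs-suc m (Rows n) (λ M → indicator (realizesR? a b M))

Fits : (a : Fin (suc m) → ℕ) (b : Fin n → ℕ) → Row n → Set
Fits a b v = weight v ≡ a fzero × v ≤ʳ b

fits? : (a : Fin (suc m) → ℕ) (b : Fin n → ℕ) (v : Row n) → Dec (Fits a b v)
fits? a b v = weight v ≟ a fzero ×-dec all? (λ j → bit (lookup v j) ≤? b j)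

completions≡0 : (a : Fin (suc m) → ℕ) (b : Fin n → ℕ) {v : Row n} → ¬ Fits a b v → completions a b v ≡ 0
completions≡0 {m} {n} a b {v} ¬fits = ∑-zero (Mats m n) (λ M → indicator-no
  (λ (rows , cols) → ¬fits (rows fzero , (λ j → subst (bit (lookup v j) ≤_) (cols j) (m≤m+n _ _))))
  (realizesR? a b (v ∷ M)))

completions≡countR : (a : Fin (suc m) → ℕ) (b : Fin n → ℕ) {v : Row n} → Fits a b v →
  completions a b v ≡ countR (λ i → a (fsuc i)) (b ∸ʳ v)
completions≡countR {m} {n} a b {v} (weight≡ , v≤b) = ∑-cong (Mats m n) (λ M → indicator-⇔
  (λ (rows , cols) → (λ i → rows (fsuc i)) ,
                     (λ j → trans (sym (m+n∸m≡n (bit (lookup v j)) _)) (cong (_∸ bit (lookup v j)) (cols j))))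
  (λ (rows , cols) → (λ { fzero → weight≡ ; (fsuc i) → rows i }) ,
                     (λ j → trans (cong (bit (lookup v j) +_) (cols j)) (m+[n∸m]≡n (v≤b j))))
  (realizesR? _ _ (v ∷ M)) (realizesR? _ _ M))

completions≡0⊎fits : (a : Fin (suc m) → ℕ) (b : Fin n → ℕ) (v : Row n) → completions a b v ≡ 0 ⊎ Fits a b v
completions≡0⊎fits a b v with fits? a b v
... | yes fits  = inj₂ fits
... | no  ¬fits = inj₁ (completions≡0 a b ¬fits)

-- Transposition

-- Prepends a column, in the form in which transpose (v ∷ M) unfolds to v ∷ᶜ transpose M.
_∷ᶜ_ : Vec A n → Vec (Vec A m) n → Vec (Vec A (suc m)) n
c ∷ᶜ M = replicate _ _∷_ ⊛ c ⊛ M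

transpose-∷ᶜ : (c : Vec A n) (M : Vec (Vec A m) n) → transpose (c ∷ᶜ M) ≡ c ∷ transpose M
transpose-∷ᶜ []      []      = refl
transpose-∷ᶜ (x ∷ c) (v ∷ M) = cong ((x ∷ v) ∷ᶜ_) (transpose-∷ᶜ c M)

lookup-∷ᶜ : (c : Vec A n) (M : Vec (Vec A m) n) (j : Fin n) → lookup (c ∷ᶜ M) j ≡ lookup c j ∷ lookup M j
lookup-∷ᶜ (x ∷ c) (v ∷ M) fzero    = refl
lookup-∷ᶜ (x ∷ c) (v ∷ M) (fsuc j) = lookup-∷ᶜ c M j

lookup-transpose : (M : Vec (Vec A n) m) (i : Fin m) (j : Fin n) →
  lookup (lookup (transpose M) j) i ≡ lookup (lookup M i) j
lookup-transpose (v ∷ M) fzero    j = cong (λ w → lookup w fzero) (lookup-∷ᶜ v (transpose M) j)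
lookup-transpose (v ∷ M) (fsuc i) j =
  trans (cong (λ w → lookup w (fsuc i)) (lookup-∷ᶜ v (transpose M) j)) (lookup-transpose M i j)

∑-allVecs-∷ᶜ : (xs : List A) (n : ℕ) (F : Vec (Vec A (suc m)) n → ℕ) →
  ∑ (allVecs n (allVecs (suc m) xs)) F ≡ ∑[ c ∈ allVecs n xs ] ∑[ M ∈ allVecs n (allVecs m xs) ] F (c ∷ᶜ M)
∑-allVecs-∷ᶜ xs zero    F = sym (+-identityʳ _)
∑-allVecs-∷ᶜ {m = m} xs (suc n) F = begin
  ∑ (allVecs (suc n) (allVecs (suc m) xs)) F
    ≡⟨ ∑-allVecs-suc n (allVecs (suc m) xs) F ⟩
  ∑[ v ∈ allVecs (suc m) xs ] ∑[ M ∈ allVecs n (allVecs (suc m) xs) ] F (v ∷ M)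
    ≡⟨ ∑-allVecs-suc m xs _ ⟩
  ∑[ x ∈ xs ] ∑[ v ∈ allVecs m xs ] ∑[ M ∈ allVecs n (allVecs (suc m) xs) ] F ((x ∷ v) ∷ M)
    ≡⟨ ∑-cong xs (λ x → ∑-cong (allVecs m xs) (λ v → ∑-allVecs-∷ᶜ xs n (λ M → F ((x ∷ v) ∷ M)))) ⟩
  ∑[ x ∈ xs ] ∑[ v ∈ allVecs m xs ] ∑[ c ∈ allVecs n xs ] ∑[ M ∈ allVecs n (allVecs m xs) ] F ((x ∷ v) ∷ (c ∷ᶜ M))
    ≡⟨ ∑-cong xs (λ x → ∑-comm (allVecs m xs) (allVecs n xs) _) ⟩
  ∑[ x ∈ xs ] ∑[ c ∈ allVecs n xs ] ∑[ v ∈ allVecs m xs ] ∑[ M ∈ allVecs n (allVecs m xs) ] F ((x ∷ c) ∷ᶜ (v ∷ M))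
    ≡⟨ ∑-cong xs (λ x → ∑-cong (allVecs n xs) λ c →
         sym (∑-allVecs-suc n (allVecs m xs) (λ M → F ((x ∷ c) ∷ᶜ M)))) ⟩
  ∑[ x ∈ xs ] ∑[ c ∈ allVecs n xs ] ∑[ M ∈ allVecs (suc n) (allVecs m xs) ] F ((x ∷ c) ∷ᶜ M)
    ≡⟨ sym (∑-allVecs-suc n xs _) ⟩
  ∑[ c ∈ allVecs (suc n) xs ] ∑[ M ∈ allVecs (suc n) (allVecs m xs) ] F (c ∷ᶜ M) ∎

∑-allVecs-[] : (n : ℕ) (F : Vec (Vec A 0) n → ℕ) → ∑ (allVecs n ([] ∷ [])) F ≡ F (replicate n [])
∑-allVecs-[] zero    F = +-identityʳ _
∑-allVecs-[] (suc n) F =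
  trans (∑-allVecs-suc n ([] ∷ []) F) (trans (+-identityʳ _) (∑-allVecs-[] n (λ M → F ([] ∷ M))))

∑-Mats-transpose : (m n : ℕ) (h : Mat m n → ℕ) → ∑ (Mats m n) h ≡ ∑[ M ∈ Mats n m ] h (transpose M)
∑-Mats-transpose zero n h =
  trans (+-identityʳ _) (sym (trans (∑-allVecs-[] n (λ M → h (transpose M))) (cong h (empty (transpose (replicate n []))))))
  where
  empty : (M : Mat 0 n) → M ≡ []
  empty [] = refl
∑-Mats-transpose (suc m) n h = begin
  ∑ (Mats (suc m) n) h
    ≡⟨ ∑-allVecs-suc m (Rows n) h ⟩
  ∑[ v ∈ Rows n ] ∑[ M ∈ Mats m n ] h (v ∷ M)
    ≡⟨ ∑-cong (Rows n) (λ v → ∑-Mats-transpose m n _) ⟩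
  ∑[ v ∈ Rows n ] ∑[ M ∈ Mats n m ] h (v ∷ transpose M)
    ≡⟨ ∑-cong (Rows n) (λ v → ∑-cong (Mats n m) (λ M → cong h (sym (transpose-∷ᶜ v M)))) ⟩
  ∑[ v ∈ Rows n ] ∑[ M ∈ Mats n m ] h (transpose (v ∷ᶜ M))
    ≡⟨ sym (∑-allVecs-∷ᶜ _ n (λ M → h (transpose M))) ⟩
  ∑[ M ∈ Mats n (suc m) ] h (transpose M) ∎

countR-transpose : (a : Fin m → ℕ) (b : Fin n → ℕ) → countR a b ≡ countR b a
countR-transpose {m} {n} a b = trans (∑-Mats-transpose m n _) (∑-cong (Mats n m) (λ M → indicator-⇔
  (λ (rows , cols) → (λ j → trans (sym (colWeight≡ M j)) (cols j)) , (λ i → trans (sym (weight≡ M i)) (rows i)))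
  (λ (rows , cols) → (λ i → trans (weight≡ M i) (cols i)) , (λ j → trans (colWeight≡ M j) (rows j)))
  (realizesR? a b (transpose M)) (realizesR? b a M)))
  where
  weight≡ : (M : Mat n m) (i : Fin m) → weight (lookup (transpose M) i) ≡ colWeight M i
  weight≡ M i = sumF-cong (λ j → cong bit (lookup-transpose M j i))
  colWeight≡ : (M : Mat n m) (j : Fin n) → colWeight (transpose M) j ≡ weight (lookup M j)
  colWeight≡ M j = sumF-cong (λ i → cong bit (lookup-transpose M j i))

-- Rows of sum one: the multinomial count

firstOnes : ℕ → Fin m → ℕ
firstOnes (suc r) fzero    = 1
firstOnes (suc r) (fsuc i) = firstOnes r i
firstOnes zero    i        = 0

blocks : ℕ → ℕ → ℕ → Fin m → ℕ
blocks k (suc q) r fzero    = k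
blocks k (suc q) r (fsuc i) = blocks k q r i
blocks k zero    r i        = firstOnes r i

∸ʳ-replicate : (b : Fin n → ℕ) → b ∸ʳ replicate n false ≗ b
∸ʳ-replicate {n} b j = cong (λ x → b j ∸ bit x) (lookup-replicate j false)

countR-zero : (a : Fin m → ℕ) (b : Fin n → ℕ) → (∀ i → a i ≡ 0) → (∀ j → b j ≡ 0) → countR a b ≡ 1
countR-zero {zero} a b a≡0 b≡0 = cong (_+ 0) (indicator-yes ((λ ()) , (λ j → sym (b≡0 j))) (realizesR? a b []))
countR-zero {suc m} {n} a b a≡0 b≡0 = begin
  countR a b
    ≡⟨ countR-suc a b ⟩
  ∑[ v ∈ Rows n ] completions a b v
    ≡⟨ ∑-Rows-single zeros _ only-zeros ⟩
  completions a b zeros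
    ≡⟨ completions≡countR a b (trans (weight-replicate {n}) (sym (a≡0 fzero)) , zeros≤b) ⟩
  countR (λ i → a (fsuc i)) (b ∸ʳ zeros)
    ≡⟨ countR-zero _ _ (λ i → a≡0 (fsuc i)) (λ j → trans (∸ʳ-replicate b j) (b≡0 j)) ⟩
  1 ∎
  where
  zeros : Row n
  zeros = replicate n false
  zeros≤b : zeros ≤ʳ b
  zeros≤b j = subst (λ x → bit x ≤ b j) (sym (lookup-replicate j false)) z≤n
  only-zeros : ConcentratedOn zeros (completions a b)
  only-zeros v = map₂ (λ (weight≡ , _) → weight≡0⇒replicate v (trans weight≡ (a≡0 fzero)))
                      (completions≡0⊎fits a b v)

!-unfold : {x : ℕ} → 1 ≤ x → x ! ≡ x * (x ∸ 1) !
!-unfold (s≤s z≤n) = refl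

prodF-!-∸unit : (b : Fin n → ℕ) (j : Fin n) → 1 ≤ b j →
  prodF (λ i → b i !) ≡ b j * prodF (λ i → (b ∸ʳ unit j) i !)
prodF-!-∸unit b fzero 1≤b₀ = begin
  b fzero ! * prodF (λ i → b (fsuc i) !)
    ≡⟨ cong₂ _*_ (!-unfold 1≤b₀) (prodF-cong (λ i → cong _! (sym (∸ʳ-replicate (λ i → b (fsuc i)) i)))) ⟩
  b fzero * (b fzero ∸ 1) ! * prodF (λ i → (b ∸ʳ unit fzero) (fsuc i) !)
    ≡⟨ *-assoc (b fzero) _ _ ⟩
  b fzero * prodF (λ i → (b ∸ʳ unit fzero) i !) ∎
prodF-!-∸unit b (fsuc j) 1≤bⱼ = begin
  b fzero ! * prodF (λ i → b (fsuc i) !)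
    ≡⟨ cong (b fzero ! *_) (prodF-!-∸unit (λ i → b (fsuc i)) j 1≤bⱼ) ⟩
  b fzero ! * (b (fsuc j) * prodF (λ i → (b ∸ʳ unit (fsuc j)) (fsuc i) !))
    ≡⟨ *-left-comm (b fzero !) (b (fsuc j)) _ ⟩
  b (fsuc j) * prodF (λ i → (b ∸ʳ unit (fsuc j)) i !) ∎

unit≤ʳ : (b : Fin n → ℕ) (j : Fin n) → 1 ≤ b j → unit j ≤ʳ b
unit≤ʳ b j 1≤bⱼ i with lookup (unit j) i in eq
... | false = z≤n
... | true  = subst (λ i → 1 ≤ b i) (sym (lookup-unit-true⇒≡ j i eq)) 1≤bⱼ

countR-firstOnes : (r : ℕ) (b : Fin n → ℕ) → r ≤ m → sumF b ≡ r →
  countR {m} (firstOnes r) b * prodF (λ j → b j !) ≡ r !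
countR-firstOnes {m = m} zero b _ Σb≡0 =
  cong₂ _*_ (countR-zero {m} (firstOnes 0) b (λ _ → refl) b≡0) (prodF-one (λ j → cong _! (b≡0 j)))
  where
  b≡0 : ∀ j → b j ≡ 0
  b≡0 = sumF≡0⇒ b Σb≡0
countR-firstOnes {n} {suc m} (suc r) b (s≤s r≤m) Σb≡1+r = begin
  countR a b * P                             ≡⟨ cong (_* P) (trans (countR-suc a b) (∑-Rows-units _ only-units)) ⟩
  sumF (λ j → completions a b (unit j)) * P  ≡⟨ sumF-*ʳ (λ j → completions a b (unit j)) P ⟩
  sumF (λ j → completions a b (unit j) * P)  ≡⟨ sumF-cong column ⟩
  sumF (λ j → b j * r !)                     ≡⟨ sym (sumF-*ʳ b (r !)) ⟩
  sumF b * r !                               ≡⟨ cong (_* r !) Σb≡1+r ⟩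
  suc r * r !                                ∎
  where
  a : Fin (suc m) → ℕ
  a = firstOnes (suc r)
  P : ℕ
  P = prodF (λ j → b j !)
  only-units : ∀ v → completions a b v ≡ 0 ⊎ weight v ≡ 1
  only-units v = map₂ proj₁ (completions≡0⊎fits a b v)
  column : ∀ j → completions a b (unit j) * P ≡ b j * r !
  column j with 1 ≤? b j
  ... | no 1≰bⱼ = begin
    completions a b (unit j) * P
      ≡⟨ cong (_* P) (completions≡0 a b λ (_ , unit≤b) → 1≰bⱼ (≤ʳ⇒1≤ (unit j) unit≤b (lookup-unit-self j))) ⟩
    0
      ≡⟨ cong (_* r !) (sym (n<1⇒n≡0 (≰⇒> 1≰bⱼ))) ⟩
    b j * r ! ∎
  ... | yes 1≤bⱼ = begin
    completions a b (unit j) * P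
      ≡⟨ cong₂ _*_ (completions≡countR a b (weight-unit j , unit≤b)) (prodF-!-∸unit b j 1≤bⱼ) ⟩
    countR {m} (firstOnes r) b′ * (b j * prodF (λ i → b′ i !))
      ≡⟨ *-left-comm (countR {m} (firstOnes r) b′) (b j) _ ⟩
    b j * (countR {m} (firstOnes r) b′ * prodF (λ i → b′ i !))
      ≡⟨ cong (b j *_) (countR-firstOnes r b′ r≤m Σb′) ⟩
    b j * r ! ∎
    where
    unit≤b : unit j ≤ʳ b
    unit≤b = unit≤ʳ b j 1≤bⱼ
    b′ : Fin n → ℕ
    b′ = b ∸ʳ unit j
    Σb′ : sumF b′ ≡ r
    Σb′ = sumF-∸ʳ {v = unit j} unit≤b (trans Σb≡1+r (cong (_+ r) (sym (weight-unit j))))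

-- Rows of sum k are forced onto the first k columns

prefix : (k n : ℕ) → Row n
prefix k       zero    = []
prefix zero    (suc n) = false ∷ prefix zero n
prefix (suc k) (suc n) = true ∷ prefix k n

lookup-prefix-< : (k : ℕ) (j : Fin n) → toℕ j < k → lookup (prefix k n) j ≡ true
lookup-prefix-< (suc k) fzero    _         = refl
lookup-prefix-< (suc k) (fsuc j) (s≤s j<k) = lookup-prefix-< k j j<k

lookup-prefix-≥ : (k : ℕ) (j : Fin n) → k ≤ toℕ j → lookup (prefix k n) j ≡ false
lookup-prefix-≥ zero    fzero    _         = refl
lookup-prefix-≥ zero    (fsuc j) _         = lookup-prefix-≥ zero j z≤n
lookup-prefix-≥ (suc k) (fsuc j) (s≤s k≤j) = lookup-prefix-≥ k j k≤j

weight-prefix : (k : ℕ) → k ≤ n → weight (prefix k n) ≡ k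
weight-prefix {zero}  zero    z≤n       = refl
weight-prefix {suc n} zero    z≤n       = weight-prefix {n} zero z≤n
weight-prefix {suc n} (suc k) (s≤s k≤n) = cong suc (weight-prefix k k≤n)

SupportedBelow : ℕ → (Fin n → ℕ) → Set
SupportedBelow k b = ∀ j → k ≤ toℕ j → b j ≡ 0

module _ {n k : ℕ} (k≤n : k ≤ n) where

  ≤ʳ∧weight⇒prefix : {b : Fin n → ℕ} → SupportedBelow k b → (v : Row n) → v ≤ʳ b → weight v ≡ k →
    v ≡ prefix k n
  ≤ʳ∧weight⇒prefix {b} b↾k v v≤b weight≡k =
    ⊆∧weight≡⇒≡ v (prefix k n) v⊆prefix (trans weight≡k (sym (weight-prefix k k≤n)))
    where
    v⊆prefix : v ⊆ prefix k n
    v⊆prefix j vⱼ≡true with toℕ j <? k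
    ... | yes j<k = lookup-prefix-< k j j<k
    ... | no  j≮k = ⊥-elim (1+n≰n (subst (1 ≤_) (b↾k j (≮⇒≥ j≮k)) (≤ʳ⇒1≤ v v≤b vⱼ≡true)))

  prefix≤ʳ : {b : Fin n → ℕ} → (∀ j → toℕ j < k → 1 ≤ b j) → prefix k n ≤ʳ b
  prefix≤ʳ 1≤b j with toℕ j <? k
  ... | yes j<k = subst (λ x → bit x ≤ _) (sym (lookup-prefix-< k j j<k)) (1≤b j j<k)
  ... | no  j≮k = subst (λ x → bit x ≤ _) (sym (lookup-prefix-≥ k j (≮⇒≥ j≮k))) z≤n

  ∸ʳprefix-< : (b : Fin n → ℕ) {j : Fin n} → toℕ j < k → (b ∸ʳ prefix k n) j ≡ b j ∸ 1
  ∸ʳprefix-< b {j} j<k = cong (λ x → b j ∸ bit x) (lookup-prefix-< k j j<k)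

  ∸ʳprefix-≥ : (b : Fin n → ℕ) {j : Fin n} → k ≤ toℕ j → (b ∸ʳ prefix k n) j ≡ b j
  ∸ʳprefix-≥ b {j} k≤j = cong (λ x → b j ∸ bit x) (lookup-prefix-≥ k j k≤j)

  supportedBelow-∸ʳprefix : {b : Fin n → ℕ} → SupportedBelow k b → SupportedBelow k (b ∸ʳ prefix k n)
  supportedBelow-∸ʳprefix {b} b↾k j k≤j = trans (∸ʳprefix-≥ b k≤j) (b↾k j k≤j)

  countR≡completions-prefix : (a : Fin (suc m) → ℕ) (b : Fin n → ℕ) → a fzero ≡ k → SupportedBelow k b →
    countR a b ≡ completions a b (prefix k n)
  countR≡completions-prefix a b a₀≡k b↾k = trans (countR-suc a b) (∑-Rows-single (prefix k n) _ only-prefix)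
    where
    only-prefix : ConcentratedOn (prefix k n) (completions a b)
    only-prefix v = map₂ (λ (weight≡ , v≤b) → ≤ʳ∧weight⇒prefix b↾k v v≤b (trans weight≡ a₀≡k))
                         (completions≡0⊎fits a b v)

  countR-blocks≡0 : (q r : ℕ) (b : Fin n → ℕ) → q ≤ m → SupportedBelow k b →
    (j : Fin n) → toℕ j < k → b j < q → countR {m} (blocks k q r) b ≡ 0
  countR-blocks≡0 {suc m} (suc q) r b (s≤s q≤m) b↾k j j<k bⱼ<1+q =
    trans (countR≡completions-prefix a b refl b↾k) (vanish (completions≡0⊎fits a b (prefix k n)))
    where
    a : Fin (suc m) → ℕ
    a = blocks k (suc q) r
    vanish : completions a b (prefix k n) ≡ 0 ⊎ Fits a b (prefix k n) → completions a b (prefix k n) ≡ 0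
    vanish (inj₁ ≡0)                  = ≡0
    vanish (inj₂ fits@(_ , prefix≤b)) = trans (completions≡countR a b fits)
      (countR-blocks≡0 q r _ q≤m (supportedBelow-∸ʳprefix b↾k) j j<k b′ⱼ<q)
      where
      1≤bⱼ : 1 ≤ b j
      1≤bⱼ = ≤ʳ⇒1≤ (prefix k n) prefix≤b (lookup-prefix-< k j j<k)
      b′ⱼ<q : (b ∸ʳ prefix k n) j < q
      b′ⱼ<q = subst (_< q) (sym (∸ʳprefix-< b j<k)) (∸-monoˡ-< bⱼ<1+q 1≤bⱼ)

  countR-blocks : (q r : ℕ) (b : Fin n → ℕ) → q + r ≤ m → SupportedBelow k b →
    (∀ j → toℕ j < k → q ≤ b j) → sumF b ≡ q * k + r → countR {m} (blocks k q r) b * prodF (λ j → (b j ∸ q) !) ≡ r !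
  countR-blocks zero r b r≤m _ _ Σb = countR-firstOnes r b r≤m Σb
  countR-blocks {suc m} (suc q) r b (s≤s q+r≤m) b↾k 1+q≤b Σb = begin
    countR a b * prodF (λ j → (b j ∸ suc q) !)
      ≡⟨ cong₂ _*_ remove-first-row (prodF-cong (λ j → cong _! (∸-suc j))) ⟩
    countR {m} (blocks k q r) b′ * prodF (λ j → (b′ j ∸ q) !)
      ≡⟨ countR-blocks q r b′ q+r≤m (supportedBelow-∸ʳprefix b↾k) q≤b′ Σb′ ⟩
    r ! ∎
    where
    a : Fin (suc m) → ℕ
    a = blocks k (suc q) r
    b′ : Fin n → ℕ
    b′ = b ∸ʳ prefix k n
    prefix≤b : prefix k n ≤ʳ b
    prefix≤b = prefix≤ʳ (λ j j<k → ≤-trans (s≤s z≤n) (1+q≤b j j<k))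
    remove-first-row : countR a b ≡ countR {m} (blocks k q r) b′
    remove-first-row = trans (countR≡completions-prefix a b refl b↾k)
                             (completions≡countR a b {prefix k n} (weight-prefix k k≤n , prefix≤b))
    ∸-suc : ∀ j → b j ∸ suc q ≡ b′ j ∸ q
    ∸-suc j with toℕ j <? k
    ... | yes j<k = trans (sym (∸-+-assoc (b j) 1 q)) (cong (_∸ q) (sym (∸ʳprefix-< b j<k)))
    ... | no  j≮k = trans (cong (_∸ suc q) (b↾k j (≮⇒≥ j≮k)))
                          (sym (trans (cong (_∸ q) (supportedBelow-∸ʳprefix b↾k j (≮⇒≥ j≮k))) (0∸n≡0 q)))
    q≤b′ : ∀ j → toℕ j < k → q ≤ b′ j
    q≤b′ j j<k = subst (q ≤_) (sym (∸ʳprefix-< b j<k)) (∸-monoˡ-≤ 1 (1+q≤b j j<k))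
    Σb′ : sumF b′ ≡ q * k + r
    Σb′ = sumF-∸ʳ {v = prefix k n} prefix≤b
      (trans Σb (trans (+-assoc k (q * k) r) (cong (_+ (q * k + r)) (sym (weight-prefix k k≤n)))))

firstOnes-< : (r : ℕ) (i : Fin m) → toℕ i < r → firstOnes r i ≡ 1
firstOnes-< (suc r) fzero    _         = refl
firstOnes-< (suc r) (fsuc i) (s≤s i<r) = firstOnes-< r i i<r

firstOnes-≥ : (r : ℕ) (i : Fin m) → r ≤ toℕ i → firstOnes r i ≡ 0
firstOnes-≥ zero    i        _         = refl
firstOnes-≥ (suc r) (fsuc i) (s≤s r≤i) = firstOnes-≥ r i r≤i

blocks-< : (k q r : ℕ) (i : Fin m) → toℕ i < q → blocks k q r i ≡ k
blocks-< k (suc q) r fzero    _         = refl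
blocks-< k (suc q) r (fsuc i) (s≤s i<q) = blocks-< k q r i i<q

blocks-mid : (k q r : ℕ) (i : Fin m) → q ≤ toℕ i → toℕ i < q + r → blocks k q r i ≡ 1
blocks-mid k zero    r i        _         i<r         = firstOnes-< r i i<r
blocks-mid k (suc q) r (fsuc i) (s≤s q≤i) (s≤s i<q+r) = blocks-mid k q r i q≤i i<q+r

blocks-≥ : (k q r : ℕ) (i : Fin m) → q + r ≤ toℕ i → blocks k q r i ≡ 0
blocks-≥ k zero    r i        r≤i           = firstOnes-≥ r i r≤i
blocks-≥ k (suc q) r (fsuc i) (s≤s q+r≤i) = blocks-≥ k q r i q+r≤i

shape≗blocks : (N k q r : ℕ) → shape N k q r ≗ blocks k q r
shape≗blocks N k q r i with toℕ i <? q
... | yes i<q = sym (blocks-< k q r i i<q)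
... | no  i≮q with toℕ i <? q + r
...   | yes i<q+r = sym (blocks-mid k q r i (≮⇒≥ i≮q) i<q+r)
...   | no  i≮q+r = sym (blocks-≥ k q r i (≮⇒≥ i≮q+r))

blocks-one : (q r : ℕ) → blocks {m} 1 q r ≗ blocks 1 (q + r) 0
blocks-one (suc q) r       fzero    = refl
blocks-one (suc q) r       (fsuc i) = blocks-one q r i
blocks-one zero    (suc r) fzero    = refl
blocks-one zero    (suc r) (fsuc i) = blocks-one zero r i
blocks-one zero    zero    i        = refl

sumF-blocks : (k q r : ℕ) → q + r ≤ m → sumF (blocks {m} k q r) ≡ q * k + r
sumF-blocks {m} k zero zero _               = sumF-zero {m} (λ _ → refl)
sumF-blocks k (suc q) r       (s≤s q+r≤m) = trans (cong (k +_) (sumF-blocks k q r q+r≤m)) (sym (+-assoc k (q * k) r))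
sumF-blocks k zero    (suc r) (s≤s r≤m)   = cong suc (sumF-blocks k zero r r≤m)

countEq≡sumF : (v : ℕ) (f : Fin m → ℕ) → countEq v f ≡ sumF (λ i → indicator (f i ≟ v))
countEq≡sumF v f =
  trans (length-filter≡∑ (λ i → f i ≟ v) (tabulate id)) (∑-tabulate id (λ i → indicator (f i ≟ v)))

countEq-cong : (v : ℕ) {f g : Fin m → ℕ} → f ≗ g → countEq v f ≡ countEq v g
countEq-cong v {f} {g} f≗g = begin
  countEq v f                          ≡⟨ countEq≡sumF v f ⟩
  sumF (λ i → indicator (f i ≟ v))     ≡⟨ sumF-cong (λ i → indicator-⇔ (trans (sym (f≗g i))) (trans (f≗g i)) _ _) ⟩
  sumF (λ i → indicator (g i ≟ v))     ≡⟨ sym (countEq≡sumF v g) ⟩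
  countEq v g                          ∎

countEq-blocks : (k q r : ℕ) → 1 ≤ k → k ≢ 1 ⊎ r ≡ 0 → q + r ≤ m → countEq k (blocks {m} k q r) ≡ q
countEq-blocks {m} k q r 1≤k k≢1∨r≡0 q+r≤m = trans (countEq≡sumF k (blocks {m} k q r)) (count q r k≢1∨r≡0 q+r≤m)
  where
  count : ∀ {l} q r → k ≢ 1 ⊎ r ≡ 0 → q + r ≤ l → sumF (λ i → indicator (blocks {l} k q r i ≟ k)) ≡ q
  count {l} zero zero _                  _           = sumF-zero {l} (λ _ → indicator-no (<⇒≢ 1≤k) (0 ≟ k))
  count (suc q) r       k≢1∨r≡0    (s≤s q+r≤m) =
    cong₂ _+_ (indicator-yes refl (k ≟ k)) (count q r k≢1∨r≡0 q+r≤m)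
  count zero    (suc r) (inj₁ k≢1) (s≤s r≤m)   =
    cong₂ _+_ (indicator-no (λ 1≡k → k≢1 (sym 1≡k)) (1 ≟ k)) (count zero r (inj₁ k≢1) r≤m)
  count zero    (suc r) (inj₂ ())  _

-- For k = 1 the entries 1 of the shape also equal k, so they join the first block.
record ShapeBlocks (N k q′ r : ℕ) : Set where
  field
    q ρ        : ℕ
    countEq≡q  : countEq k (shape N k q′ r) ≡ q
    q+ρ≤N      : q + ρ ≤ N
    shape≗     : shape N k q′ r ≗ blocks k q ρ

shapeBlocks : (N k q′ r : ℕ) → 1 ≤ k → q′ + r ≤ N → ShapeBlocks N k q′ r
shapeBlocks N 1 q′ r 1≤k q′+r≤N = record
  { q         = q′ + r
  ; ρ         = 0
  ; countEq≡q = trans (countEq-cong 1 shape≗) (countEq-blocks 1 (q′ + r) 0 1≤k (inj₂ refl) q′+r+0≤N)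
  ; q+ρ≤N     = q′+r+0≤N
  ; shape≗    = shape≗
  }
  where
  shape≗ : shape N 1 q′ r ≗ blocks 1 (q′ + r) 0
  shape≗ i = trans (shape≗blocks N 1 q′ r i) (blocks-one q′ r i)
  q′+r+0≤N : q′ + r + 0 ≤ N
  q′+r+0≤N = subst (_≤ N) (sym (+-identityʳ _)) q′+r≤N
shapeBlocks N k@(suc (suc _)) q′ r 1≤k q′+r≤N = record
  { q         = q′
  ; ρ         = r
  ; countEq≡q = trans (countEq-cong k (shape≗blocks N k q′ r)) (countEq-blocks k q′ r 1≤k (inj₁ λ ()) q′+r≤N)
  ; q+ρ≤N     = q′+r≤N
  ; shape≗    = shape≗blocks N k q′ r
  }

pad-supportedBelow : (k N : ℕ) (x : Fin k → ℕ) → SupportedBelow k (pad k N x)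
pad-supportedBelow k N x j k≤j with toℕ j <? k
... | yes j<k = ⊥-elim (<⇒≱ j<k k≤j)
... | no  _   = refl

pad-< : (k N : ℕ) (x : Fin k → ℕ) (j : Fin N) (j<k : toℕ j < k) → pad k N x j ≡ x (fromℕ< j<k)
pad-< k N x j j<k with toℕ j <? k
... | yes j<k′ = cong x (fromℕ<-cong (toℕ j) (toℕ j) refl j<k′ j<k)
... | no  j≮k  = ⊥-elim (j≮k j<k)

pad-inject≤ : (k N : ℕ) (x : Fin k → ℕ) (k≤N : k ≤ N) (i : Fin k) → pad k N x (inject≤ i k≤N) ≡ x i
pad-inject≤ k N x k≤N i = trans (pad-< k N x (inject≤ i k≤N) i′<k)
  (cong x (trans (fromℕ<-cong _ (toℕ i) (toℕ-inject≤ i k≤N) i′<k (toℕ<n i)) (fromℕ<-toℕ i (toℕ<n i))))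
  where
  i′<k : toℕ (inject≤ i k≤N) < k
  i′<k = subst (_< k) (sym (toℕ-inject≤ i k≤N)) (toℕ<n i)

sumF-inject≤ : (k≤n : k ≤ n) (f : Fin n → ℕ) → SupportedBelow k f → sumF f ≡ sumF (λ i → f (inject≤ i k≤n))
sumF-inject≤ {zero}  z≤n       f f↾k = sumF-zero (λ j → f↾k j z≤n)
sumF-inject≤ {suc k} (s≤s k≤n) f f↾k =
  cong (f fzero +_) (sumF-inject≤ k≤n (λ j → f (fsuc j)) (λ j k≤j → f↾k (fsuc j) (s≤s k≤j)))

prodF-inject≤ : (k≤n : k ≤ n) (f : Fin n → ℕ) → (∀ j → k ≤ toℕ j → f j ≡ 1) →
  prodF f ≡ prodF (λ i → f (inject≤ i k≤n))
prodF-inject≤ {zero}  z≤n       f f≡1 = prodF-one (λ j → f≡1 j z≤n)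
prodF-inject≤ {suc k} (s≤s k≤n) f f≡1 =
  cong (f fzero *_) (prodF-inject≤ k≤n (λ j → f (fsuc j)) (λ j k≤j → f≡1 (fsuc j) (s≤s k≤j)))

minF<⇒∃ : (k : ℕ) (x : Fin (suc k) → ℕ) {c : ℕ} → minF (suc k) x < c → Σ[ i ∈ Fin (suc k) ] x i < c
minF<⇒∃ zero    x x₀<c = fzero , x₀<c
minF<⇒∃ (suc k) x {c} min<c with ⊓-sel (x fzero) (minF (suc k) (λ i → x (fsuc i)))
... | inj₁ min≡x₀ = fzero , subst (_< c) min≡x₀ min<c
... | inj₂ min≡min′ with minF<⇒∃ k (λ i → x (fsuc i)) (subst (_< c) min≡min′ min<c)
...   | i , xᵢ<c = fsuc i , xᵢ<c

≤minF⇒≤ : (k : ℕ) (x : Fin k → ℕ) {c : ℕ} → c ≤ minF k x → ∀ i → c ≤ x i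
≤minF⇒≤ (suc zero)    x c≤min fzero    = c≤min
≤minF⇒≤ (suc (suc k)) x c≤min fzero    = ≤-trans c≤min (m⊓n≤m _ _)
≤minF⇒≤ (suc (suc k)) x c≤min (fsuc i) = ≤minF⇒≤ (suc k) (λ i → x (fsuc i)) (≤-trans c≤min (m⊓n≤n _ _)) i

MatchesFormula : (k : ℕ) → (Fin k → ℕ) → ℕ → ℕ → Set
MatchesFormula k x q c =
  (minF k x < q → c ≡ 0) × (q ≤ minF k x → c * prodF (λ i → (x i ∸ q) !) ≡ (sumF x ∸ q * k) !)

countR-blocks-pad : {k N q ρ : ℕ} → 1 ≤ k → k ≤ N → q + ρ ≤ N → (x : Fin k → ℕ) → sumF x ≡ q * k + ρ →
  MatchesFormula k x q (countR (blocks {N} k q ρ) (pad k N x))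
countR-blocks-pad {k@(suc k′)} {N} {q} {ρ} (s≤s z≤n) k≤N q+ρ≤N x Σx = none , count
  where
  a b : Fin N → ℕ
  a = blocks k q ρ
  b = pad k N x
  b↾k : SupportedBelow k b
  b↾k = pad-supportedBelow k N x
  none : minF k x < q → countR a b ≡ 0
  none min<q with minF<⇒∃ k′ x min<q
  ... | i , xᵢ<q = countR-blocks≡0 k≤N q ρ b (m+n≤o⇒m≤o q q+ρ≤N) b↾k (inject≤ i k≤N)
    (subst (_< k) (sym (toℕ-inject≤ i k≤N)) (toℕ<n i)) (subst (_< q) (sym (pad-inject≤ k N x k≤N i)) xᵢ<q)
  count : q ≤ minF k x → countR a b * prodF (λ i → (x i ∸ q) !) ≡ (sumF x ∸ q * k) !
  count q≤min = begin
    countR a b * prodF (λ i → (x i ∸ q) !)  ≡⟨ cong (countR a b *_) (sym prodF≡) ⟩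
    countR a b * prodF (λ j → (b j ∸ q) !)  ≡⟨ countR-blocks k≤N q ρ b q+ρ≤N b↾k q≤b Σb ⟩
    ρ !                                     ≡⟨ cong _! (sym (trans (cong (_∸ q * k) Σx) (m+n∸m≡n (q * k) ρ))) ⟩
    (sumF x ∸ q * k) !                      ∎
    where
    q≤b : ∀ j → toℕ j < k → q ≤ b j
    q≤b j j<k = subst (q ≤_) (sym (pad-< k N x j j<k)) (≤minF⇒≤ k x q≤min (fromℕ< j<k))
    Σb : sumF b ≡ q * k + ρ
    Σb = trans (sumF-inject≤ k≤N b b↾k) (trans (sumF-cong (pad-inject≤ k N x k≤N)) Σx)
    prodF≡ : prodF (λ j → (b j ∸ q) !) ≡ prodF (λ i → (x i ∸ q) !)
    prodF≡ = trans (prodF-inject≤ k≤N _ λ j k≤j → trans (cong (λ y → (y ∸ q) !) (b↾k j k≤j)) (cong _! (0∸n≡0 q)))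
                   (prodF-cong λ i → cong (λ y → (y ∸ q) !) (pad-inject≤ k N x k≤N i))

lemma1 : (k N : ℕ) → 1 ≤ k → 1 ≤ N → k ≤ N →
    (x : Fin k → ℕ) → (q' r : ℕ) → q' + r ≤ N →
    sumF x ≡ sumF (shape N k q' r) →
    ((minF k x < countEq k (shape N k q' r) →
        numRealizations (pad k N x) (shape N k q' r) ≡ 0)
     × (countEq k (shape N k q' r) ≤ minF k x →
        numRealizations (pad k N x) (shape N k q' r)
          * prodF (λ i → (x i ∸ countEq k (shape N k q' r)) !)
          ≡ (sumF x ∸ countEq k (shape N k q' r) * k) !))
    × ((minF k x < countEq k (shape N k q' r) →
        numRealizations (shape N k q' r) (pad k N x) ≡ 0)
     × (countEq k (shape N k q' r) ≤ minF k x →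
        numRealizations (shape N k q' r) (pad k N x)
          * prodF (λ i → (x i ∸ countEq k (shape N k q' r)) !)
          ≡ (sumF x ∸ countEq k (shape N k q' r) * k) !))
lemma1 k N 1≤k _ k≤N x q′ r q′+r≤N Σx≡Σshape =
  subst₂ (MatchesFormula k x) (sym countEq≡q) (sym pad-shape) formula ,
  subst₂ (MatchesFormula k x) (sym countEq≡q) (sym shape-pad) formula
  where
  open ShapeBlocks (shapeBlocks N k q′ r 1≤k q′+r≤N)
  formula : MatchesFormula k x q (countR (blocks {N} k q ρ) (pad k N x))
  formula = countR-blocks-pad 1≤k k≤N q+ρ≤N x
    (trans Σx≡Σshape (trans (sumF-cong shape≗) (sumF-blocks k q ρ q+ρ≤N)))
  shape-pad : numRealizations (shape N k q′ r) (pad k N x) ≡ countR (blocks {N} k q ρ) (pad k N x)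
  shape-pad = trans (numRealizations≡countR (shape N k q′ r) (pad k N x)) (countR-cong shape≗ (λ _ → refl))
  pad-shape : numRealizations (pad k N x) (shape N k q′ r) ≡ countR (blocks {N} k q ρ) (pad k N x)
  pad-shape = trans (numRealizations≡countR (pad k N x) (shape N k q′ r))
                    (trans (countR-transpose (pad k N x) (shape N k q′ r)) (countR-cong shape≗ (λ _ → refl)))
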